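{- Let $\varphi_q:\mathbb C\langle A\rangle\to\mathbb C_q[X]$ be the algebra homomorphism determined by $a_i\mapsto x_i$. Then for every permutation $\sigma\in\mathfrak S_n$, $$\varphi_q(\mathbf F_\sigma)=q^{\ell(\sigma)}\,\overline F_{C(\sigma)} .$$
   Context: $A=\{a_1<a_2<\cdots\}$ is an infinite totally ordered alphabet; permutations are identified with words; for a word $w$, $\mathrm{Std}(w)$ is its standardization (number left to right the occurrences of the smallest letter $1,2,\dots$, then those of the next smallest letter, etc.); $\mathbf F_\sigma=\sum_{w:\mathrm{Std}(w)=\sigma^{ -1}}w$. $q$ is a complex parameter (or indeterminate), and $\mathbb C_q[X]$ is the quantum affine space: the associative algebra generated by $x_1,x_2,\dots$ subject to $x_jx_i=q\,x_ix_j$ for $j>i$. $\ell(\sigma)$ is the number of inversions of $\sigma$. The descent set of $\sigma$ is $\mathrm{Des}(\sigma)=\{i:\sigma(i)>\sigma(i+1)\}$ and $C(\sigma)$ is the composition of $n$ whose set of partial sums (other than $n$) is $\mathrm{Des}(\sigma)$. For a composition $I=(i_1,\dots,i_r)$, $\overline M_I=\sum_{j_1<\cdots<j_r}x_{j_1}^{i_1}\cdots x_{j_r}^{i_r}\in\mathbb C_q[X]$ and $\overline F_I=\sum_J\overline M_J$, the sum over all compositions $J$ of $|I|$ refining $I$ (i.e. whose set of partial sums contains that of $I$). -}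

module Defs where

open import Level using (Level)
open import Data.Nat using (ℕ; zero; suc; _∸_; _<ᵇ_; _≤ᵇ_; _≡ᵇ_)
open import Data.Bool using (Bool; true; false; if_then_else_; _∧_; _∨_)
open import Data.Product using (_×_; _,_)
open import Data.Fin using (Fin; toℕ)
open import Data.Fin.Permutation using (Permutation; _⟨$⟩ʳ_; _⟨$⟩ˡ_)
open import Data.Vec using (Vec; []; _∷_; lookup; tabulate)
import Data.Vec.Properties as VP
open import Data.List using (List; []; _∷_; [_]; _++_; upTo; map; concatMap; allFin; foldr)
open import Data.Bool.ListAction using (all; any)
open import Data.Nat.ListAction using (sum)
import Data.List.Properties as LP
import Data.Nat.Properties as NP
open import Relation.Nullary using (does)
open import Algebra.Bundles using (CommutativeRing)

-- Letters a_1 < a_2 < ... are encoded by natural numbers 0 < 1 < 2 < ...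
-- A permutation σ ∈ S_n is identified with the word σ(1)…σ(n); values are
-- encoded 0-based (toℕ), positions by Fin n.

count : {A : Set} → (A → Bool) → List A → ℕ
count p [] = 0
count p (x ∷ xs) = if p x then suc (count p xs) else count p xs

-- all words of length n over the letters 0 … N-1 (alphabet truncated to a_1..a_N)
words : (N n : ℕ) → List (Vec ℕ n)
words N zero = [ [] ]
words N (suc n) = concatMap (λ a → map (a ∷_) (words N n)) (upTo N)

std : {n : ℕ} → Vec ℕ n → Vec ℕ n
std {n} w = tabulate λ i → count
  (λ k → (lookup w k <ᵇ lookup w i) ∨ ((toℕ k <ᵇ toℕ i) ∧ (lookup w k ≡ᵇ lookup w i)))
  (allFin n)

invWord : {n : ℕ} → Permutation n n → Vec ℕ n
invWord σ = tabulate λ i → toℕ (σ ⟨$⟩ˡ i)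

stdIsInv : {n : ℕ} → Permutation n n → Vec ℕ n → Bool
stdIsInv σ w = does (VP.≡-dec NP._≟_ (std w) (invWord σ))

inversions : {n : ℕ} → Permutation n n → ℕ
inversions {n} σ = count
  (λ p → (toℕ (Data.Product.proj₁ p) <ᵇ toℕ (Data.Product.proj₂ p)) ∧
         (toℕ (σ ⟨$⟩ʳ Data.Product.proj₂ p) <ᵇ toℕ (σ ⟨$⟩ʳ Data.Product.proj₁ p)))
  (Data.List.cartesianProduct (allFin n) (allFin n))

permWord : {n : ℕ} → Permutation n n → List ℕ
permWord {n} σ = map (λ i → toℕ (σ ⟨$⟩ʳ i)) (allFin n)

-- descent positions (1-based) of a word: i with x_i > x_{i+1}
descAux : ℕ → List ℕ → List ℕ
descAux i (x ∷ rest@(y ∷ xs)) = if y <ᵇ x then i ∷ descAux (suc i) rest else descAux (suc i) rest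
descAux i _ = []

Des : {n : ℕ} → Permutation n n → List ℕ
Des σ = descAux 1 (permWord σ)

diffs : ℕ → List ℕ → List ℕ
diffs prev [] = []
diffs prev (d ∷ ds) = (d ∸ prev) ∷ diffs d ds

-- composition of n whose partial sums other than n form the (increasing) set D
compOfSet : ℕ → List ℕ → List ℕ
compOfSet zero D = []
compOfSet (suc n) D = diffs 0 (D ++ [ suc n ])

C : {n : ℕ} → Permutation n n → List ℕ
C {n} σ = compOfSet n (Des σ)

-- all compositions of m (lists of positive integers summing to m); first arg is fuel
compsF : ℕ → ℕ → List (List ℕ)
compsF _ zero = [ [] ]
compsF zero (suc m) = []
compsF (suc f) (suc m) = concatMap (λ k → map (suc k ∷_) (compsF f (m ∸ k))) (upTo (suc m))

compositions : ℕ → List (List ℕ)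
compositions n = compsF n n

partialSumsFrom : ℕ → List ℕ → List ℕ
partialSumsFrom s [] = []
partialSumsFrom s (i ∷ is) = (s Data.Nat.+ i) ∷ partialSumsFrom (s Data.Nat.+ i) is

partialSums : List ℕ → List ℕ
partialSums = partialSumsFrom 0

refines : List ℕ → List ℕ → Bool
refines J I = all (λ s → any (s ≡ᵇ_) (partialSums J)) (partialSums I)

-- exponent composition of a normal-ordered monomial x_{j1}^{e1}…x_{jr}^{er}
-- (j1<…<jr) given as the weakly increasing list of its letters: (e1,…,er)
runsAux : ℕ → ℕ → List ℕ → List ℕ
runsAux c k [] = [ k ]
runsAux c k (y ∷ ys) = if c ≡ᵇ y then runsAux c (suc k) ys else k ∷ runsAux y 1 ys

expComp : List ℕ → List ℕ
expComp [] = []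
expComp (x ∷ xs) = runsAux x 1 xs

listEq : List ℕ → List ℕ → Bool
listEq u v = does (LP.≡-dec NP._≟_ u v)

-- Quantum affine space over a commutative ring R with parameter q,
-- presented by its PBW basis of normal-ordered monomials
-- x_{j1} x_{j2} … x_{jk} with j1 ≤ j2 ≤ … ≤ jk (stored as that weakly
-- increasing list).  Right multiplication of a normal monomial by x_j uses
-- the defining relation x_b x_a = q x_a x_b (b > a) to move x_j left past
-- every factor x_i with i > j.

module Quantum {c ℓ : Level} (R : CommutativeRing c ℓ) (q : CommutativeRing.Carrier R) where
  open CommutativeRing R

  pow : Carrier → ℕ → Carrier
  pow x zero = 1#
  pow x (suc k) = x * pow x k

  insert : ℕ → List ℕ → List ℕ
  insert j [] = [ j ]
  insert j (i ∷ xs) = if j ≤ᵇ i then j ∷ i ∷ xs else i ∷ insert j xs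

  Term : Set c
  Term = Carrier × List ℕ

  mulVar : Term → ℕ → Term
  mulVar (a , m) j = (a * pow q (count (j <ᵇ_) m) , insert j m)

  mulWord : Term → List ℕ → Term
  mulWord t [] = t
  mulWord t (j ∷ js) = mulWord (mulVar t j) js

  φ : {n : ℕ} → Vec ℕ n → Term
  φ w = mulWord (1# , []) (Data.Vec.toList w)

  coeffAt : List ℕ → Term → Carrier
  coeffAt u (a , m) = if listEq m u then a else 0#

  Σ : {A : Set} → List A → (A → Carrier) → Carrier
  Σ xs f = foldr (λ x acc → f x + acc) 0# xs

  -- coefficient of u in φ_q(F_σ), F_σ restricted to the alphabet a_1..a_N
  -- (F_σ = Σ_{w : Std(w) = σ⁻¹} w)
  lhsCoeff : {n : ℕ} → Permutation n n → (N : ℕ) → List ℕ → Carrier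
  lhsCoeff {n} σ N u =
    Σ (words N n) λ w → if stdIsInv σ w then coeffAt u (φ w) else 0#

  -- coefficient of u in M̄_J (u normal-ordered, letters among x_1..x_N)
  MbarCoeff : List ℕ → List ℕ → Carrier
  MbarCoeff J u = if listEq (expComp u) J then 1# else 0#

  -- coefficient of u in F̄_I = Σ_{J ⊨ |I|, J refines I} M̄_J
  FbarCoeff : List ℕ → List ℕ → Carrier
  FbarCoeff I u = Σ (compositions (sum I)) λ J →
    if refines J I then MbarCoeff J u else 0#

{-# OPTIONS --safe #-}
-- Multiplying out φ_q(w) in normal order gives q^inv(w) times the sorted rearrangement of w,
-- and inv(w) = ℓ(Std w) = ℓ(σ) whenever Std(w) = σ⁻¹.  A word is determined by its sorted
-- rearrangement u and its standardization, w_i = u_{σ⁻¹(i)}, so the coefficient of the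
-- monomial u in φ_q(F_σ) is q^ℓ(σ) if this word really standardizes to σ⁻¹, and 0 otherwise.
-- That happens exactly when u increases strictly at every descent of σ, i.e. when the
-- composition of exponents of u refines C(σ): exactly the monomials of F̄_C(σ), each with
-- coefficient 1.
module Submission where

open import Defs
open import Level using (Level; 0ℓ)
open import Algebra.Bundles using (CommutativeRing)
import Algebra.Properties.CommutativeMonoid.Sum as CommutativeMonoidSum
open import Data.Bool using (Bool; true; false; T; if_then_else_; _∧_; _∨_; not)
open import Data.Bool.Properties using (T-∧; T-∨; ∧-comm)
open import Data.Empty using (⊥-elim)
open import Data.Fin using (Fin; zero; suc; toℕ; fromℕ<)
import Data.Fin.Properties as Finₚ
open import Data.Fin.Permutation using (Permutation; _⟨$⟩ʳ_; _⟨$⟩ˡ_; inverseˡ; inverseʳ)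
open import Data.List using (List; []; _∷_; [_]; _++_; length; map; allFin)
import Data.List as List
import Data.List.Properties as Listₚ
open import Data.List.Membership.Propositional using (_∈_)
open import Data.List.Membership.Propositional.Properties using (∈-++⁺ˡ; ∈-++⁺ʳ; ∈-++⁻)
open import Data.List.Relation.Binary.Permutation.Propositional as ↭ using (_↭_)
import Data.List.Relation.Binary.Permutation.Propositional.Properties as ↭ₚ
open import Data.List.Relation.Binary.Subset.Propositional using (_⊆_)
open import Data.List.Relation.Unary.All as All using (All)
open import Data.List.Relation.Unary.All.Properties using (all⁺; all⁻)
open import Data.List.Relation.Unary.Any as Any using (here; there)
open import Data.List.Relation.Unary.Any.Properties using (any⁺; any⁻)
open import Data.List.Relation.Unary.Linked as Linked using (Linked)
open import Data.List.Relation.Unary.Linked.Properties using (Linked⇒All)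
open import Data.Nat using (ℕ; zero; suc; _+_; _∸_; _≤_; _<_; _<ᵇ_; _≤ᵇ_; _≡ᵇ_; z≤n; s≤s; s≤s⁻¹; z<s)
open import Data.Nat.ListAction using (sum)
open import Data.Nat.Properties
open import Data.Nat.Solver using (module +-*-Solver)
open +-*-Solver using (solve; _:+_; _:=_)
import Data.List.Sort.InsertionSort.Base ≤-decTotalOrder as InsertionSort
import Data.List.Sort.InsertionSort.Properties ≤-decTotalOrder as InsertionSortₚ
open import Data.Product using (_×_; _,_; proj₁; proj₂; ∃-syntax)
open import Data.Product.Relation.Binary.Lex.Strict using (×-Lex; ×-isStrictTotalOrder)
open import Data.Sum using (_⊎_; inj₁; inj₂)
open import Data.Vec using (Vec; lookup; tabulate; toList)
import Data.Vec.Properties as Vecₚ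
open import Function using (id; _∘_; _⇔_; mk⇔; Equivalence)
open import Relation.Binary using (Rel; IsStrictTotalOrder; tri<; tri≈; tri>)
open import Relation.Binary.PropositionalEquality
  using (_≡_; _≢_; refl; sym; trans; cong; cong₂; subst; subst₂; module ≡-Reasoning)
import Relation.Binary.Reasoning.Setoid as SetoidReasoning
open import Relation.Nullary using (¬_; Dec; yes; no)
open import Relation.Nullary.Decidable using (dec-true; dec-false)

-- Counting over lists and over Fin n

𝟙 : Bool → ℕ
𝟙 true = 1
𝟙 false = 0

module ℕ-Σ = CommutativeMonoidSum +-0-commutativeMonoid

countFin : {n : ℕ} → (Fin n → Bool) → ℕ
countFin p = ℕ-Σ.sum (λ k → 𝟙 (p k))

count-∷ : {A : Set} (p : A → Bool) (x : A) (xs : List A) → count p (x ∷ xs) ≡ 𝟙 (p x) + count p xs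
count-∷ p x xs with p x
... | true = refl
... | false = refl

count-∷-T : {A : Set} (p : A → Bool) (x : A) (xs : List A) → T (p x) → count p (x ∷ xs) ≡ suc (count p xs)
count-∷-T p x xs px with p x
... | true = refl
... | false = ⊥-elim px

count-tabulate : {A : Set} {n : ℕ} (p : A → Bool) (f : Fin n → A) → count p (List.tabulate f) ≡ countFin (p ∘ f)
count-tabulate {n = zero} p f = refl
count-tabulate {n = suc n} p f =
  trans (count-∷ p (f zero) (List.tabulate (f ∘ suc))) (cong (𝟙 (p (f zero)) +_) (count-tabulate p (f ∘ suc)))

count-toList : {n : ℕ} (p : ℕ → Bool) (w : Vec ℕ n) → count p (toList w) ≡ countFin (p ∘ lookup w)
count-toList p Vec.[] = refl
count-toList p (x Vec.∷ w) = trans (count-∷ p x (toList w)) (cong (𝟙 (p x) +_) (count-toList p w))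

count-++ : {A : Set} (p : A → Bool) (xs ys : List A) → count p (xs ++ ys) ≡ count p xs + count p ys
count-++ p [] ys = refl
count-++ p (x ∷ xs) ys with p x
... | true = cong suc (count-++ p xs ys)
... | false = count-++ p xs ys

count-map : {A B : Set} (p : B → Bool) (f : A → B) (xs : List A) → count p (map f xs) ≡ count (p ∘ f) xs
count-map p f [] = refl
count-map p f (x ∷ xs) = cong (λ c → if p (f x) then suc c else c) (count-map p f xs)

count-↭ : {A : Set} (p : A → Bool) {xs ys : List A} → xs ↭ ys → count p xs ≡ count p ys
count-↭ p ↭.refl = refl
count-↭ p (↭.prep x xs↭ys) = cong (λ c → if p x then suc c else c) (count-↭ p xs↭ys)
count-↭ p (↭.swap x y xs↭ys) with p x | p y
... | true  | true  = cong (λ c → suc (suc c)) (count-↭ p xs↭ys)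
... | true  | false = cong suc (count-↭ p xs↭ys)
... | false | true  = cong suc (count-↭ p xs↭ys)
... | false | false = count-↭ p xs↭ys
count-↭ p (↭.trans xs↭ys ys↭zs) = trans (count-↭ p xs↭ys) (count-↭ p ys↭zs)

count-none : {A : Set} (p : A → Bool) {xs : List A} → All (λ x → ¬ T (p x)) xs → count p xs ≡ 0
count-none p All.[] = refl
count-none p {x ∷ xs} (¬px All.∷ ¬pxs) with p x
... | true = ⊥-elim (¬px _)
... | false = count-none p ¬pxs

countFin-cong : {n : ℕ} {p p′ : Fin n → Bool} → (∀ k → p k ≡ p′ k) → countFin p ≡ countFin p′
countFin-cong p≗p′ = ℕ-Σ.sum-cong-≗ (cong 𝟙 ∘ p≗p′)

𝟙-mono : {a b : Bool} → (T a → T b) → 𝟙 a ≤ 𝟙 b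
𝟙-mono {false} a⇒b = z≤n
𝟙-mono {true} {true} a⇒b = ≤-refl
𝟙-mono {true} {false} a⇒b = ⊥-elim (a⇒b _)

countFin-mono : {n : ℕ} {p p′ : Fin n → Bool} → (∀ k → T (p k) → T (p′ k)) → countFin p ≤ countFin p′
countFin-mono {zero} p⇒p′ = z≤n
countFin-mono {suc n} p⇒p′ = +-mono-≤ (𝟙-mono (p⇒p′ zero)) (countFin-mono (p⇒p′ ∘ suc))

countFin-mono-< : {n : ℕ} {p p′ : Fin n → Bool} → (∀ k → T (p k) → T (p′ k)) →
                  (k : Fin n) → ¬ T (p k) → T (p′ k) → countFin p < countFin p′
countFin-mono-< {suc n} {p} {p′} p⇒p′ zero ¬pk p′k with p zero | p′ zero
... | true  | _     = ⊥-elim (¬pk _)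
... | false | false = ⊥-elim p′k
... | false | true  = s≤s (countFin-mono (p⇒p′ ∘ suc))
countFin-mono-< {suc n} p⇒p′ (suc k) ¬pk p′k =
  +-mono-≤-< (𝟙-mono (p⇒p′ zero)) (countFin-mono-< (p⇒p′ ∘ suc) k ¬pk p′k)

countFin-permute : {n : ℕ} (p : Fin n → Bool) (π : Permutation n n) → countFin p ≡ countFin (p ∘ (π ⟨$⟩ʳ_))
countFin-permute p π = ℕ-Σ.sum-permute (𝟙 ∘ p) π

countFin-toℕ< : {n : ℕ} (m : ℕ) → m ≤ n → countFin {n} (λ j → toℕ j <ᵇ m) ≡ m
countFin-toℕ< {n} zero _ = ℕ-Σ.sum-replicate-zero n
countFin-toℕ< (suc m) (s≤s m≤n) = cong suc (countFin-toℕ< m m≤n)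

T-injective : {a b : Bool} → (T a ⇔ T b) → a ≡ b
T-injective {false} {false} _ = refl
T-injective {false} {true} a⇔b = ⊥-elim (Equivalence.from a⇔b _)
T-injective {true} {false} a⇔b = ⊥-elim (Equivalence.to a⇔b _)
T-injective {true} {true} _ = refl

-- Standardization

_<ₗₑₓ_ : Rel (ℕ × ℕ) 0ℓ
_<ₗₑₓ_ = ×-Lex _≡_ _<_ _<_

module Lex = IsStrictTotalOrder (×-isStrictTotalOrder <-isStrictTotalOrder <-isStrictTotalOrder)

-- Spelled exactly as the comparison inside Defs.std, so that std-lookup holds by computation.
_<ₗₑₓᵇ_ : ℕ × ℕ → ℕ × ℕ → Bool
(a , x) <ₗₑₓᵇ (b , y) = (a <ᵇ b) ∨ ((x <ᵇ y) ∧ (a ≡ᵇ b))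

<ₗₑₓᵇ⇒<ₗₑₓ : (p p′ : ℕ × ℕ) → T (p <ₗₑₓᵇ p′) → p <ₗₑₓ p′
<ₗₑₓᵇ⇒<ₗₑₓ (a , x) (b , y) h with Equivalence.to T-∨ h
... | inj₁ a<b = inj₁ (<ᵇ⇒< a b a<b)
... | inj₂ h′ with Equivalence.to T-∧ h′
...   | x<y , a≡b = inj₂ (≡ᵇ⇒≡ a b a≡b , <ᵇ⇒< x y x<y)

<ₗₑₓ⇒<ₗₑₓᵇ : {p p′ : ℕ × ℕ} → p <ₗₑₓ p′ → T (p <ₗₑₓᵇ p′)
<ₗₑₓ⇒<ₗₑₓᵇ (inj₁ a<b) = Equivalence.from T-∨ (inj₁ (<⇒<ᵇ a<b))
<ₗₑₓ⇒<ₗₑₓᵇ {a , _} {b , _} (inj₂ (a≡b , x<y)) =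
  Equivalence.from T-∨ (inj₂ (Equivalence.from T-∧ (<⇒<ᵇ x<y , ≡⇒≡ᵇ a b a≡b)))

<ₗₑₓ⇒≤₁ : {p p′ : ℕ × ℕ} → p <ₗₑₓ p′ → proj₁ p ≤ proj₁ p′
<ₗₑₓ⇒≤₁ (inj₁ a<b) = <⇒≤ a<b
<ₗₑₓ⇒≤₁ (inj₂ (a≡b , _)) = ≤-reflexive a≡b

key : {n : ℕ} → Vec ℕ n → Fin n → ℕ × ℕ
key w i = lookup w i , toℕ i

key-injective : {n : ℕ} (w : Vec ℕ n) {k i : Fin n} → key w k ≡ key w i → k ≡ i
key-injective w = Finₚ.toℕ-injective ∘ cong proj₂

std-lookup : {n : ℕ} (w : Vec ℕ n) (i : Fin n) → lookup (std w) i ≡ countFin (λ k → key w k <ₗₑₓᵇ key w i)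
std-lookup w i = trans (Vecₚ.lookup∘tabulate _ i) (count-tabulate (λ k → key w k <ₗₑₓᵇ key w i) id)

std-mono : {n : ℕ} (w : Vec ℕ n) {k i : Fin n} → key w k <ₗₑₓ key w i → lookup (std w) k < lookup (std w) i
std-mono w {k} {i} k<i = subst₂ _<_ (sym (std-lookup w k)) (sym (std-lookup w i))
  (countFin-mono-< below-k⇒below-i k (Lex.irrefl (refl , refl) ∘ <ₗₑₓᵇ⇒<ₗₑₓ (key w k) (key w k))
                   (<ₗₑₓ⇒<ₗₑₓᵇ k<i))
  where
  below-k⇒below-i : ∀ j → T (key w j <ₗₑₓᵇ key w k) → T (key w j <ₗₑₓᵇ key w i)
  below-k⇒below-i j j<k = <ₗₑₓ⇒<ₗₑₓᵇ (Lex.trans (<ₗₑₓᵇ⇒<ₗₑₓ (key w j) (key w k) j<k) k<i)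

std-<⇔ : {n : ℕ} (w : Vec ℕ n) (k i : Fin n) → lookup (std w) k < lookup (std w) i ⇔ key w k <ₗₑₓ key w i
std-<⇔ w k i = mk⇔ reflects (std-mono w)
  where
  reflects : lookup (std w) k < lookup (std w) i → key w k <ₗₑₓ key w i
  reflects k<i with Lex.compare (key w k) (key w i)
  ... | tri< k<ₗi _ _ = k<ₗi
  ... | tri≈ _ (e₁ , e₂) _ with refl ← key-injective w (cong₂ _,_ e₁ e₂) = ⊥-elim (<-irrefl refl k<i)
  ... | tri> _ _ i<ₗk = ⊥-elim (<-asym k<i (std-mono w i<ₗk))

rank : {n : ℕ} → Permutation n n → Fin n → ℕ
rank σ i = toℕ (σ ⟨$⟩ˡ i)

rank-σ : {n : ℕ} (σ : Permutation n n) (j : Fin n) → rank σ (σ ⟨$⟩ʳ j) ≡ toℕ j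
rank-σ σ j = cong toℕ (inverseˡ σ)

rank<n : {n : ℕ} (σ : Permutation n n) (i : Fin n) → rank σ i < n
rank<n σ i = Finₚ.toℕ<n (σ ⟨$⟩ˡ i)

rank-injective : {n : ℕ} (σ : Permutation n n) {k i : Fin n} → rank σ k ≡ rank σ i → k ≡ i
rank-injective σ {k} {i} e = begin
  k                       ≡⟨ sym (inverseʳ σ) ⟩
  σ ⟨$⟩ʳ (σ ⟨$⟩ˡ k)       ≡⟨ cong (σ ⟨$⟩ʳ_) (Finₚ.toℕ-injective e) ⟩
  σ ⟨$⟩ʳ (σ ⟨$⟩ˡ i)       ≡⟨ inverseʳ σ ⟩
  i                       ∎
  where open ≡-Reasoning

std≡invWord⇔ : {n : ℕ} (σ : Permutation n n) (w : Vec ℕ n) →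
               std w ≡ invWord σ ⇔ (∀ i → lookup (std w) i ≡ rank σ i)
std≡invWord⇔ σ w = mk⇔
  (λ std≡ i → trans (cong (λ v → lookup v i) std≡) (Vecₚ.lookup∘tabulate (rank σ) i))
  (λ std≗ → trans (sym (Vecₚ.tabulate∘lookup (std w))) (Vecₚ.tabulate-cong std≗))

rank-<⇔ : {n : ℕ} (σ : Permutation n n) (w : Vec ℕ n) → std w ≡ invWord σ →
          (k i : Fin n) → rank σ k < rank σ i ⇔ key w k <ₗₑₓ key w i
rank-<⇔ σ w std≡ k i = subst₂ (λ a b → (a < b) ⇔ (key w k <ₗₑₓ key w i)) (std≗ k) (std≗ i) (std-<⇔ w k i)
  where
  std≗ : ∀ j → lookup (std w) j ≡ rank σ j
  std≗ = Equivalence.to (std≡invWord⇔ σ w) std≡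

countFin-rank< : {n : ℕ} (σ : Permutation n n) (m : ℕ) → m ≤ n → countFin (λ k → rank σ k <ᵇ m) ≡ m
countFin-rank< {n} σ m m≤n = begin
  countFin (λ k → rank σ k <ᵇ m)              ≡⟨ countFin-permute (λ k → rank σ k <ᵇ m) σ ⟩
  countFin (λ j → rank σ (σ ⟨$⟩ʳ j) <ᵇ m)     ≡⟨ countFin-cong (λ j → cong (_<ᵇ m) (rank-σ σ j)) ⟩
  countFin {n} (λ j → toℕ j <ᵇ m)             ≡⟨ countFin-toℕ< m m≤n ⟩
  m                                           ∎
  where open ≡-Reasoning

-- Inversions

inversionsOf : {n : ℕ} → (Fin n → ℕ) → ℕ
inversionsOf f = ℕ-Σ.sum λ r → countFin λ t → (toℕ r <ᵇ toℕ t) ∧ (f t <ᵇ f r)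

inversionsOf-cong : {n : ℕ} {f g : Fin n → ℕ} →
                    (∀ {r t} → toℕ r < toℕ t → (f t < f r) ⇔ (g t < g r)) → inversionsOf f ≡ inversionsOf g
inversionsOf-cong {f = f} {g} same = ℕ-Σ.sum-cong-≗ λ r → countFin-cong λ t → inverted-pair r t
  where
  inverted-pair : ∀ r t → (toℕ r <ᵇ toℕ t) ∧ (f t <ᵇ f r) ≡ (toℕ r <ᵇ toℕ t) ∧ (g t <ᵇ g r)
  inverted-pair r t with toℕ r <ᵇ toℕ t in r<t
  ... | false = refl
  ... | true = T-injective (mk⇔ (<⇒<ᵇ ∘ to ∘ <ᵇ⇒< _ _) (<⇒<ᵇ ∘ from ∘ <ᵇ⇒< _ _))
    where open Equivalence (same {r} {t} (<ᵇ⇒< _ _ (subst T (sym r<t) _)))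

count-cartesianProduct : {A B : Set} {n : ℕ} (p : A × B → Bool) (f : Fin n → A) (ys : List B) →
  count p (List.cartesianProduct (List.tabulate f) ys) ≡ ℕ-Σ.sum (λ i → count (λ y → p (f i , y)) ys)
count-cartesianProduct {n = zero} p f ys = refl
count-cartesianProduct {n = suc n} p f ys = trans (count-++ p (map (f zero ,_) ys) _)
  (cong₂ _+_ (count-map p (f zero ,_) ys) (count-cartesianProduct p (f ∘ suc) ys))

inversions≡inversionsOf : {n : ℕ} (σ : Permutation n n) →
                          inversions σ ≡ inversionsOf (λ j → toℕ (σ ⟨$⟩ʳ j))
inversions≡inversionsOf {n} σ = trans (count-cartesianProduct inverted id (allFin n))
  (ℕ-Σ.sum-cong-≗ λ i → count-tabulate (λ j → inverted (i , j)) id)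
  where
  inverted : Fin n × Fin n → Bool
  inverted (i , j) = (toℕ i <ᵇ toℕ j) ∧ (toℕ (σ ⟨$⟩ʳ j) <ᵇ toℕ (σ ⟨$⟩ʳ i))

inversionsOf-inverse : {n : ℕ} (σ : Permutation n n) →
                       inversionsOf (rank σ) ≡ inversionsOf (λ j → toℕ (σ ⟨$⟩ʳ j))
inversionsOf-inverse {n} σ = begin
  ℕ-Σ.sum (λ r → ℕ-Σ.sum (λ t → F r t))
    ≡⟨ ℕ-Σ.sum-permute (λ r → ℕ-Σ.sum (λ t → F r t)) σ ⟩
  ℕ-Σ.sum (λ a → ℕ-Σ.sum (λ t → F (σ ⟨$⟩ʳ a) t))
    ≡⟨ ℕ-Σ.sum-cong-≗ (λ a → ℕ-Σ.sum-permute (F (σ ⟨$⟩ʳ a)) σ) ⟩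
  ℕ-Σ.sum (λ a → ℕ-Σ.sum (λ b → F (σ ⟨$⟩ʳ a) (σ ⟨$⟩ʳ b)))
    ≡⟨ ℕ-Σ.sum-cong-≗ (λ a → ℕ-Σ.sum-cong-≗ (λ b →
         cong 𝟙 (cong₂ (λ x y → (σ′ a <ᵇ σ′ b) ∧ (x <ᵇ y)) (rank-σ σ b) (rank-σ σ a)))) ⟩
  ℕ-Σ.sum (λ a → ℕ-Σ.sum (λ b → 𝟙 ((σ′ a <ᵇ σ′ b) ∧ (toℕ b <ᵇ toℕ a))))
    ≡⟨ ℕ-Σ.∑-comm (λ a b → 𝟙 ((σ′ a <ᵇ σ′ b) ∧ (toℕ b <ᵇ toℕ a))) ⟩
  ℕ-Σ.sum (λ b → ℕ-Σ.sum (λ a → 𝟙 ((σ′ a <ᵇ σ′ b) ∧ (toℕ b <ᵇ toℕ a))))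
    ≡⟨ ℕ-Σ.sum-cong-≗ (λ b → ℕ-Σ.sum-cong-≗ (λ a →
         cong 𝟙 (∧-comm (σ′ a <ᵇ σ′ b) (toℕ b <ᵇ toℕ a)))) ⟩
  inversionsOf σ′ ∎
  where
  open ≡-Reasoning
  σ′ : Fin n → ℕ
  σ′ j = toℕ (σ ⟨$⟩ʳ j)
  F : Fin n → Fin n → ℕ
  F r t = 𝟙 ((toℕ r <ᵇ toℕ t) ∧ (rank σ t <ᵇ rank σ r))

inversionsOf-std : {n : ℕ} (σ : Permutation n n) (w : Vec ℕ n) → std w ≡ invWord σ →
                   inversionsOf (lookup w) ≡ inversions σ
inversionsOf-std σ w std≡ = begin
  inversionsOf (lookup w)                 ≡⟨ inversionsOf-cong same-inversions ⟩
  inversionsOf (rank σ)                   ≡⟨ inversionsOf-inverse σ ⟩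
  inversionsOf (λ j → toℕ (σ ⟨$⟩ʳ j))     ≡⟨ sym (inversions≡inversionsOf σ) ⟩
  inversions σ                            ∎
  where
  open ≡-Reasoning
  same-inversions : ∀ {r t} → toℕ r < toℕ t → lookup w t < lookup w r ⇔ rank σ t < rank σ r
  same-inversions {r} {t} r<t = mk⇔
    (Equivalence.from (rank-<⇔ σ w std≡ t r) ∘ inj₁)
    (λ rank[t]<rank[r] → case-tie (Equivalence.to (rank-<⇔ σ w std≡ t r) rank[t]<rank[r]))
    where
    case-tie : key w t <ₗₑₓ key w r → lookup w t < lookup w r
    case-tie (inj₁ w[t]<w[r]) = w[t]<w[r]
    case-tie (inj₂ (_ , t<r)) = ⊥-elim (<-asym r<t t<r)

wordInversions : List ℕ → ℕ
wordInversions [] = 0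
wordInversions (j ∷ js) = count (_<ᵇ j) js + wordInversions js

wordInversions-toList : {n : ℕ} (w : Vec ℕ n) → wordInversions (toList w) ≡ inversionsOf (lookup w)
wordInversions-toList Vec.[] = refl
wordInversions-toList (x Vec.∷ w) = cong₂ _+_ (count-toList (_<ᵇ x) w) (wordInversions-toList w)

-- Sorted lists

-- Out-of-range positions read as 0.
nth : List ℕ → ℕ → ℕ
nth [] _ = 0
nth (x ∷ xs) zero = x
nth (x ∷ xs) (suc j) = nth xs j

nth-All : {P : ℕ → Set} {u : List ℕ} → All P u → (j : ℕ) → j < length u → P (nth u j)
nth-All (pu All.∷ _) zero _ = pu
nth-All (_ All.∷ pus) (suc j) j<len = nth-All pus j (s≤s⁻¹ j<len)

nth-ext : (xs ys : List ℕ) → length xs ≡ length ys → (∀ j → j < length xs → nth xs j ≡ nth ys j) → xs ≡ ys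
nth-ext [] [] _ _ = refl
nth-ext (x ∷ xs) (y ∷ ys) len≡ nth≗ =
  cong₂ _∷_ (nth≗ 0 z<s) (nth-ext xs ys (suc-injective len≡) (λ j j<len → nth≗ (suc j) (s≤s j<len)))

head≤ : {y : ℕ} {L : List ℕ} → Linked _≤_ (y ∷ L) → All (y ≤_) (y ∷ L)
head≤ = Linked⇒All ≤-trans ≤-refl

nth-mono : {u : List ℕ} → Linked _≤_ u → {a b : ℕ} → a ≤ b → b < length u → nth u a ≤ nth u b
nth-mono {y ∷ u} u↗ {zero} {b} _ b<len = nth-All (head≤ u↗) b b<len
nth-mono {y ∷ u} u↗ {suc a} {suc b} (s≤s a≤b) b<len = nth-mono (Linked.tail u↗) a≤b (s≤s⁻¹ b<len)

nth-sorted-count : (L : List ℕ) {x : ℕ} (j : ℕ) → Linked _≤_ L →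
                   count (_<ᵇ x) L ≤ j → j < count (_≤ᵇ x) L → nth L j ≡ x
nth-sorted-count [] j _ _ ()
nth-sorted-count (y ∷ L) {x} j L↗ lo hi with <-cmp y x | j
... | tri< y<x _ _ | zero = ⊥-elim (n≮0 (subst (_≤ 0) (count-∷-T (_<ᵇ x) y L (<⇒<ᵇ y<x)) lo))
... | tri< y<x _ _ | suc j′ = nth-sorted-count L j′ (Linked.tail L↗)
  (s≤s⁻¹ (subst (_≤ suc j′) (count-∷-T (_<ᵇ x) y L (<⇒<ᵇ y<x)) lo))
  (s≤s⁻¹ (subst (suc j′ <_) (count-∷-T (_≤ᵇ x) y L (≤⇒≤ᵇ (<⇒≤ y<x))) hi))
... | tri≈ _ refl _ | zero = refl
... | tri≈ _ refl _ | suc j′ = nth-sorted-count L j′ (Linked.tail L↗)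
  (subst (_≤ j′) (sym none-below) z≤n)
  (s≤s⁻¹ (subst (suc j′ <_) (count-∷-T (_≤ᵇ y) y L (≤⇒≤ᵇ (≤-refl {y}))) hi))
  where
  none-below : count (_<ᵇ y) L ≡ 0
  none-below = count-none (_<ᵇ y)
    (All.map (λ y≤z z<y → <-irrefl refl (≤-<-trans y≤z (<ᵇ⇒< _ _ z<y))) (All.tail (head≤ L↗)))
... | tri> _ _ x<y | j′ = ⊥-elim (n≮0 (subst (j′ <_) none-atMost hi))
  where
  none-atMost : count (_≤ᵇ x) (y ∷ L) ≡ 0
  none-atMost = count-none (_≤ᵇ x)
    (All.map (λ y≤z z≤x → <-irrefl refl (<-≤-trans x<y (≤-trans y≤z (≤ᵇ⇒≤ _ _ z≤x)))) (head≤ L↗))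

-- Words standardizing to σ⁻¹

nth-permWord : {n : ℕ} (σ : Permutation n n) (j : Fin n) → nth (permWord σ) (toℕ j) ≡ toℕ (σ ⟨$⟩ʳ j)
nth-permWord {n} σ j =
  trans (cong (λ l → nth l (toℕ j)) (Listₚ.map-tabulate id (λ i → toℕ (σ ⟨$⟩ʳ i)))) (nth-tabulate _ j)
  where
  nth-tabulate : {m : ℕ} (g : Fin m → ℕ) (j : Fin m) → nth (List.tabulate g) (toℕ j) ≡ g j
  nth-tabulate g zero = refl
  nth-tabulate g (suc j) = nth-tabulate (g ∘ suc) j

nth-permWord-rank : {n : ℕ} (σ : Permutation n n) (k : Fin n) → nth (permWord σ) (rank σ k) ≡ toℕ k
nth-permWord-rank σ k = trans (nth-permWord σ (σ ⟨$⟩ˡ k)) (cong toℕ (inverseʳ σ))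

StrictAtDescents : {n : ℕ} → Permutation n n → List ℕ → Set
StrictAtDescents {n} σ u =
  ∀ b → suc b < n → nth (permWord σ) (suc b) < nth (permWord σ) b → nth u b < nth u (suc b)

unsort : {n : ℕ} → Permutation n n → List ℕ → Vec ℕ n
unsort σ u = tabulate (λ i → nth u (rank σ i))

lookup-unsort : {n : ℕ} (σ : Permutation n n) (u : List ℕ) (i : Fin n) → lookup (unsort σ u) i ≡ nth u (rank σ i)
lookup-unsort σ u i = Vecₚ.lookup∘tabulate _ i

rank-σ-fromℕ< : {n b : ℕ} (σ : Permutation n n) (b<n : b < n) → rank σ (σ ⟨$⟩ʳ fromℕ< b<n) ≡ b
rank-σ-fromℕ< σ b<n = trans (rank-σ σ (fromℕ< b<n)) (Finₚ.toℕ-fromℕ< b<n)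

nth-permWord-fromℕ< : {n b : ℕ} (σ : Permutation n n) (b<n : b < n) →
                      nth (permWord σ) b ≡ toℕ (σ ⟨$⟩ʳ fromℕ< b<n)
nth-permWord-fromℕ< σ b<n =
  trans (cong (nth (permWord σ)) (sym (Finₚ.toℕ-fromℕ< b<n))) (nth-permWord σ (fromℕ< b<n))

lookup-unsort-fromℕ< : {n b : ℕ} (σ : Permutation n n) (u : List ℕ) (b<n : b < n) →
                       lookup (unsort σ u) (σ ⟨$⟩ʳ fromℕ< b<n) ≡ nth u b
lookup-unsort-fromℕ< σ u b<n = trans (lookup-unsort σ u _) (cong (nth u) (rank-σ-fromℕ< σ b<n))

std-unsort⇒strictAtDescents : {n : ℕ} (σ : Permutation n n) (u : List ℕ) →
                               std (unsort σ u) ≡ invWord σ → StrictAtDescents σ u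
std-unsort⇒strictAtDescents {n} σ u std≡ b 1+b<n descent =
  ordered (Equivalence.to (rank-<⇔ σ (unsort σ u) std≡ i k)
    (subst₂ _<_ (sym (rank-σ-fromℕ< σ b<n)) (sym (rank-σ-fromℕ< σ 1+b<n)) (n<1+n b)))
  where
  b<n : b < n
  b<n = <-trans (n<1+n b) 1+b<n
  i k : Fin n
  i = σ ⟨$⟩ʳ fromℕ< b<n
  k = σ ⟨$⟩ʳ fromℕ< 1+b<n
  ordered : key (unsort σ u) i <ₗₑₓ key (unsort σ u) k → nth u b < nth u (suc b)
  ordered (inj₁ u[b]<u[1+b]) =
    subst₂ _<_ (lookup-unsort-fromℕ< σ u b<n) (lookup-unsort-fromℕ< σ u 1+b<n) u[b]<u[1+b]
  ordered (inj₂ (_ , i<k)) =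
    ⊥-elim (<-asym descent (subst₂ _<_ (sym (nth-permWord-fromℕ< σ b<n)) (sym (nth-permWord-fromℕ< σ 1+b<n)) i<k))

nth-permWord-injective : {n a b : ℕ} (σ : Permutation n n) → a < n → b < n →
                         nth (permWord σ) a ≡ nth (permWord σ) b → a ≡ b
nth-permWord-injective σ a<n b<n σa≡σb = begin
  _                            ≡⟨ sym (rank-σ-fromℕ< σ a<n) ⟩
  rank σ (σ ⟨$⟩ʳ fromℕ< a<n)   ≡⟨ cong (rank σ) (Finₚ.toℕ-injective σa≡σb′) ⟩
  rank σ (σ ⟨$⟩ʳ fromℕ< b<n)   ≡⟨ rank-σ-fromℕ< σ b<n ⟩
  _                            ∎
  where
  open ≡-Reasoning
  σa≡σb′ : toℕ (σ ⟨$⟩ʳ fromℕ< a<n) ≡ toℕ (σ ⟨$⟩ʳ fromℕ< b<n)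
  σa≡σb′ = trans (sym (nth-permWord-fromℕ< σ a<n)) (trans σa≡σb (nth-permWord-fromℕ< σ b<n))

module _ {n : ℕ} (σ : Permutation n n) {u : List ℕ} (u↗ : Linked _≤_ u) (|u|≡n : length u ≡ n)
         (strict : StrictAtDescents σ u) where

  private
    nth-u-mono : {a b : ℕ} → a ≤ b → b < n → nth u a ≤ nth u b
    nth-u-mono a≤b b<n = nth-mono u↗ a≤b (subst (_ <_) (sym |u|≡n) b<n)

  permWord-ascends-at-tie : ∀ a → suc a < n → nth u a ≡ nth u (suc a) →
                            nth (permWord σ) a < nth (permWord σ) (suc a)
  permWord-ascends-at-tie a 1+a<n tie with <-cmp (nth (permWord σ) a) (nth (permWord σ) (suc a))
  ... | tri< ascent _ _ = ascent
  ... | tri≈ _ σa≡σ[1+a] _ =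
    ⊥-elim (<-irrefl (nth-permWord-injective σ (<-trans (n<1+n a) 1+a<n) 1+a<n σa≡σ[1+a]) (n<1+n a))
  ... | tri> _ _ descent = ⊥-elim (<-irrefl tie (strict a 1+a<n descent))

  permWord-increasing-on-ties : ∀ {a b} → a < b → b < n → nth u a ≡ nth u b →
                                nth (permWord σ) a < nth (permWord σ) b
  permWord-increasing-on-ties {a} {suc b} a<1+b 1+b<n tie with m<1+n⇒m<n∨m≡n a<1+b
  ... | inj₂ refl = permWord-ascends-at-tie a 1+b<n tie
  ... | inj₁ a<b = <-trans (permWord-increasing-on-ties a<b b<n tie-a-b) (permWord-ascends-at-tie b 1+b<n tie-b-1+b)
    where
    b<n : b < n
    b<n = <-trans (n<1+n b) 1+b<n
    tie-a-b : nth u a ≡ nth u b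
    tie-a-b = ≤-antisym (nth-u-mono (<⇒≤ a<b) b<n) (subst (nth u b ≤_) (sym tie) (nth-u-mono (n≤1+n b) 1+b<n))
    tie-b-1+b : nth u b ≡ nth u (suc b)
    tie-b-1+b = trans (sym tie-a-b) tie

  rank-<⇒key-unsort : ∀ {k i} → rank σ k < rank σ i → key (unsort σ u) k <ₗₑₓ key (unsort σ u) i
  rank-<⇒key-unsort {k} {i} k<i with m≤n⇒m<n∨m≡n (nth-u-mono (<⇒≤ k<i) (rank<n σ i))
  ... | inj₁ u<u = inj₁ (subst₂ _<_ (sym (lookup-unsort σ u k)) (sym (lookup-unsort σ u i)) u<u)
  ... | inj₂ tie = inj₂ ( trans (lookup-unsort σ u k) (trans tie (sym (lookup-unsort σ u i)))
                        , subst₂ _<_ (nth-permWord-rank σ k) (nth-permWord-rank σ i)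
                            (permWord-increasing-on-ties k<i (rank<n σ i) tie))

  rank-<⇔key-unsort : ∀ k i → rank σ k < rank σ i ⇔ key (unsort σ u) k <ₗₑₓ key (unsort σ u) i
  rank-<⇔key-unsort k i = mk⇔ rank-<⇒key-unsort reflects
    where
    reflects : key (unsort σ u) k <ₗₑₓ key (unsort σ u) i → rank σ k < rank σ i
    reflects k<ₗi with <-cmp (rank σ k) (rank σ i)
    ... | tri< k<i _ _ = k<i
    ... | tri≈ _ k≡i _ with refl ← rank-injective σ k≡i = ⊥-elim (Lex.irrefl (refl , refl) k<ₗi)
    ... | tri> _ _ i<k = ⊥-elim (Lex.asym k<ₗi (rank-<⇒key-unsort i<k))

  strictAtDescents⇒std-unsort : std (unsort σ u) ≡ invWord σ
  strictAtDescents⇒std-unsort = Equivalence.from (std≡invWord⇔ σ (unsort σ u)) λ i → begin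
    lookup (std w) i                         ≡⟨ std-lookup w i ⟩
    countFin (λ k → key w k <ₗₑₓᵇ key w i)   ≡⟨ countFin-cong (λ k → T-injective (same-order k i)) ⟩
    countFin (λ k → rank σ k <ᵇ rank σ i)    ≡⟨ countFin-rank< σ (rank σ i) (<⇒≤ (rank<n σ i)) ⟩
    rank σ i                                 ∎
    where
    open ≡-Reasoning
    w : Vec ℕ n
    w = unsort σ u
    same-order : ∀ k i → T (key w k <ₗₑₓᵇ key w i) ⇔ T (rank σ k <ᵇ rank σ i)
    same-order k i = mk⇔
      (<⇒<ᵇ ∘ Equivalence.from (rank-<⇔key-unsort k i) ∘ <ₗₑₓᵇ⇒<ₗₑₓ (key w k) (key w i))
      (<ₗₑₓ⇒<ₗₑₓᵇ ∘ Equivalence.to (rank-<⇔key-unsort k i) ∘ <ᵇ⇒< _ _)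

-- Descent sets and compositions

positionsAfter : (ℕ → ℕ → Bool) → ℕ → ℕ → List ℕ → List ℕ
positionsAfter r i x [] = []
positionsAfter r i x (y ∷ ys) =
  if r x y then i ∷ positionsAfter r (suc i) y ys else positionsAfter r (suc i) y ys

descAux≡positionsAfter : (i x : ℕ) (ys : List ℕ) → descAux i (x ∷ ys) ≡ positionsAfter (λ x y → y <ᵇ x) i x ys
descAux≡positionsAfter i x [] = refl
descAux≡positionsAfter i x (y ∷ ys) =
  cong (λ l → if y <ᵇ x then i ∷ l else l) (descAux≡positionsAfter (suc i) y ys)

∈-if-∷⁺ˡ : {a : ℕ} {L : List ℕ} (c : Bool) → T c → a ∈ (if c then a ∷ L else L)
∈-if-∷⁺ˡ true _ = here refl

∈-if-∷⁺ʳ : {d a : ℕ} {L : List ℕ} (c : Bool) → d ∈ L → d ∈ (if c then a ∷ L else L)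
∈-if-∷⁺ʳ true = there
∈-if-∷⁺ʳ false = id

∈-if-∷⁻ : {d a : ℕ} {L : List ℕ} (c : Bool) → d ∈ (if c then a ∷ L else L) → (T c × d ≡ a) ⊎ d ∈ L
∈-if-∷⁻ true (here d≡a) = inj₁ (_ , d≡a)
∈-if-∷⁻ true (there d∈) = inj₂ d∈
∈-if-∷⁻ false d∈ = inj₂ d∈

∈-positionsAfter⁺ : (r : ℕ → ℕ → Bool) (i x : ℕ) (ys : List ℕ) {b : ℕ} → b < length ys →
                    T (r (nth (x ∷ ys) b) (nth ys b)) → i + b ∈ positionsAfter r i x ys
∈-positionsAfter⁺ r i x (y ∷ ys) {zero} _ rxy =
  subst (_∈ positionsAfter r i x (y ∷ ys)) (sym (+-identityʳ i)) (∈-if-∷⁺ˡ (r x y) rxy)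
∈-positionsAfter⁺ r i x (y ∷ ys) {suc b} 1+b<len rb = ∈-if-∷⁺ʳ (r x y)
  (subst (_∈ positionsAfter r (suc i) y ys) (sym (+-suc i b)) (∈-positionsAfter⁺ r (suc i) y ys (s≤s⁻¹ 1+b<len) rb))

∈-positionsAfter⁻ : (r : ℕ → ℕ → Bool) (i x : ℕ) (ys : List ℕ) {d : ℕ} → d ∈ positionsAfter r i x ys →
                    ∃[ b ] (d ≡ i + b × b < length ys × T (r (nth (x ∷ ys) b) (nth ys b)))
∈-positionsAfter⁻ r i x (y ∷ ys) d∈ with ∈-if-∷⁻ (r x y) d∈
... | inj₁ (rxy , d≡i) = 0 , trans d≡i (sym (+-identityʳ i)) , z<s , rxy
... | inj₂ d∈′ with ∈-positionsAfter⁻ r (suc i) y ys d∈′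
...   | b , d≡1+i+b , b<len , rb = suc b , trans d≡1+i+b (sym (+-suc i b)) , s≤s b<len , rb

positionsAfter-linked : (r : ℕ → ℕ → Bool) {b i t : ℕ} (x : ℕ) (ys : List ℕ) → b ≤ i → i + length ys ≤ t →
                        Linked _≤_ (b ∷ positionsAfter r i x ys ++ [ t ])
positionsAfter-linked r {i = i} x [] b≤i i+0≤t = ≤-trans b≤i (≤-trans (m≤m+n i 0) i+0≤t) Linked.∷ Linked.[-]
positionsAfter-linked r {b} {i} {t} x (y ∷ ys) b≤i bound with r x y
... | true = b≤i Linked.∷ positionsAfter-linked r y ys (n≤1+n i) (subst (_≤ t) (+-suc i (length ys)) bound)
... | false = positionsAfter-linked r y ys (≤-trans b≤i (n≤1+n i)) (subst (_≤ t) (+-suc i (length ys)) bound)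

descAux-linked : (xs : List ℕ) → Linked _≤_ (0 ∷ descAux 1 xs ++ [ length xs ])
descAux-linked [] = z≤n Linked.∷ Linked.[-]
descAux-linked (x ∷ ys) =
  subst (λ l → Linked _≤_ (0 ∷ l ++ [ suc (length ys) ])) (sym (descAux≡positionsAfter 1 x ys))
  (positionsAfter-linked (λ x y → y <ᵇ x) x ys z≤n ≤-refl)

length-permWord : {n : ℕ} (σ : Permutation n n) → length (permWord σ) ≡ n
length-permWord {n} σ = trans (Listₚ.length-map _ (allFin n)) (Listₚ.length-tabulate id)

Des-linked : {n : ℕ} (σ : Permutation n n) → Linked _≤_ (0 ∷ Des σ ++ [ n ])
Des-linked σ = subst (λ m → Linked _≤_ (0 ∷ Des σ ++ [ m ])) (length-permWord σ) (descAux-linked (permWord σ))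

partialSumsFrom-diffs : {p : ℕ} (L : List ℕ) → Linked _≤_ (p ∷ L) → partialSumsFrom p (diffs p L) ≡ L
partialSumsFrom-diffs [] _ = refl
partialSumsFrom-diffs {p} (d ∷ L) (p≤d Linked.∷ L↗) =
  cong₂ _∷_ (m+[n∸m]≡n p≤d)
    (trans (cong (λ s → partialSumsFrom s (diffs d L)) (m+[n∸m]≡n p≤d)) (partialSumsFrom-diffs L L↗))

sum-diffs : {p t : ℕ} (L : List ℕ) → Linked _≤_ (p ∷ L ++ [ t ]) → p + sum (diffs p (L ++ [ t ])) ≡ t
sum-diffs {p} {t} [] (p≤t Linked.∷ _) = trans (cong (p +_) (+-identityʳ (t ∸ p))) (m+[n∸m]≡n p≤t)
sum-diffs {p} {t} (d ∷ L) (p≤d Linked.∷ L↗) = begin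
  p + ((d ∸ p) + sum (diffs d (L ++ [ t ])))   ≡⟨ sym (+-assoc p (d ∸ p) _) ⟩
  (p + (d ∸ p)) + sum (diffs d (L ++ [ t ]))   ≡⟨ cong (_+ sum (diffs d (L ++ [ t ]))) (m+[n∸m]≡n p≤d) ⟩
  d + sum (diffs d (L ++ [ t ]))               ≡⟨ sum-diffs L L↗ ⟩
  t                                            ∎
  where open ≡-Reasoning

sum-C : {n : ℕ} (σ : Permutation n n) → sum (C σ) ≡ n
sum-C {zero} σ = refl
sum-C {suc n} σ = sum-diffs (Des σ) (Des-linked σ)

partialSums-C : {n : ℕ} (σ : Permutation (suc n) (suc n)) → partialSums (C σ) ≡ Des σ ++ [ suc n ]
partialSums-C σ = partialSumsFrom-diffs _ (Des-linked σ)

_≢ᵇ_ : ℕ → ℕ → Bool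
x ≢ᵇ y = not (x ≡ᵇ y)

sum-runsAux : (c k : ℕ) (ys : List ℕ) → sum (runsAux c k ys) ≡ k + length ys
sum-runsAux c k [] = refl
sum-runsAux c k (y ∷ ys) with c ≡ᵇ y
... | true = trans (sum-runsAux c (suc k) ys) (sym (+-suc k (length ys)))
... | false = cong (k +_) (sum-runsAux y 1 ys)

runsAux-positive : (c k : ℕ) (ys : List ℕ) → 0 < k → All (0 <_) (runsAux c k ys)
runsAux-positive c k [] 0<k = 0<k All.∷ All.[]
runsAux-positive c k (y ∷ ys) 0<k with c ≡ᵇ y
... | true = runsAux-positive c (suc k) ys z<s
... | false = 0<k All.∷ runsAux-positive y 1 ys z<s

partialSumsFrom-runsAux : (p c k : ℕ) (ys : List ℕ) →
  partialSumsFrom p (runsAux c k ys) ≡ positionsAfter _≢ᵇ_ (p + k) c ys ++ [ p + k + length ys ]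
partialSumsFrom-runsAux p c k [] = cong [_] (sym (+-identityʳ (p + k)))
partialSumsFrom-runsAux p c k (y ∷ ys) with c ≡ᵇ y in c≡ᵇy
... | true with refl ← ≡ᵇ⇒≡ c y (subst T (sym c≡ᵇy) _) =
  trans (partialSumsFrom-runsAux p c (suc k) ys)
        (cong₂ (λ s e → positionsAfter _≢ᵇ_ s c ys ++ [ e ]) (+-suc p k)
               (trans (cong (_+ length ys) (+-suc p k)) (sym (+-suc (p + k) (length ys)))))
... | false = cong ((p + k) ∷_) (trans (partialSumsFrom-runsAux (p + k) y 1 ys)
        (cong₂ (λ s e → positionsAfter _≢ᵇ_ s y ys ++ [ e ]) (+-comm (p + k) 1) (+-assoc (p + k) 1 (length ys))))

sum-expComp : (u : List ℕ) → sum (expComp u) ≡ length u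
sum-expComp [] = refl
sum-expComp (x ∷ xs) = sum-runsAux x 1 xs

expComp-positive : (u : List ℕ) → All (0 <_) (expComp u)
expComp-positive [] = All.[]
expComp-positive (x ∷ xs) = runsAux-positive x 1 xs z<s

partialSums-expComp : (x : ℕ) (xs : List ℕ) →
                      partialSums (expComp (x ∷ xs)) ≡ positionsAfter _≢ᵇ_ 1 x xs ++ [ suc (length xs) ]
partialSums-expComp x xs = partialSumsFrom-runsAux 0 x 1 xs

T-refines⇔ : (J I : List ℕ) → T (refines J I) ⇔ partialSums I ⊆ partialSums J
T-refines⇔ J I = mk⇔
  (λ J≼I {s} s∈I → Any.map (≡ᵇ⇒≡ s _) (any⁻ (s ≡ᵇ_) _ (All.lookup (all⁺ _ _ J≼I) s∈I)))
  (λ I⊆J → all⁻ _ (All.tabulate (λ {s} s∈I → any⁺ (s ≡ᵇ_) (Any.map (≡⇒≡ᵇ s _) (I⊆J s∈I)))))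

≢⇒≢ᵇ : {a c : ℕ} → a ≢ c → T (a ≢ᵇ c)
≢⇒≢ᵇ {a} {c} a≢c with a ≡ᵇ c in a≡ᵇc
... | true = a≢c (≡ᵇ⇒≡ a c (subst T (sym a≡ᵇc) _))
... | false = _

≢ᵇ⇒≢ : {a c : ℕ} → T (a ≢ᵇ c) → a ≢ c
≢ᵇ⇒≢ {a} {c} a≢ᵇc a≡c with a ≡ᵇ c | ≡⇒≡ᵇ a c a≡c
... | true | _ = a≢ᵇc
... | false | ()

∈-descAux⁺ : (xs : List ℕ) {b : ℕ} → suc b < length xs → nth xs (suc b) < nth xs b → suc b ∈ descAux 1 xs
∈-descAux⁺ (x ∷ ys) 1+b<len descent = subst (_ ∈_) (sym (descAux≡positionsAfter 1 x ys))
  (∈-positionsAfter⁺ (λ x y → y <ᵇ x) 1 x ys (s≤s⁻¹ 1+b<len) (<⇒<ᵇ descent))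

∈-descAux⁻ : (xs : List ℕ) {d : ℕ} → d ∈ descAux 1 xs →
             ∃[ b ] (d ≡ suc b × suc b < length xs × nth xs (suc b) < nth xs b)
∈-descAux⁻ (x ∷ ys) d∈
  with ∈-positionsAfter⁻ (λ x y → y <ᵇ x) 1 x ys (subst (_ ∈_) (descAux≡positionsAfter 1 x ys) d∈)
... | b , d≡1+b , b<len , descent = b , d≡1+b , s≤s b<len , <ᵇ⇒< _ _ descent

∈-changes⁺ : (x : ℕ) (xs : List ℕ) {b : ℕ} → suc b < length (x ∷ xs) →
             nth (x ∷ xs) b ≢ nth xs b → suc b ∈ positionsAfter _≢ᵇ_ 1 x xs
∈-changes⁺ x xs 1+b<len change = ∈-positionsAfter⁺ _≢ᵇ_ 1 x xs (s≤s⁻¹ 1+b<len) (≢⇒≢ᵇ change)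

∈-changes⁻ : (x : ℕ) (xs : List ℕ) {d : ℕ} → d ∈ positionsAfter _≢ᵇ_ 1 x xs →
             ∃[ b ] (d ≡ suc b × suc b < length (x ∷ xs) × nth (x ∷ xs) b ≢ nth xs b)
∈-changes⁻ x xs d∈ with ∈-positionsAfter⁻ _≢ᵇ_ 1 x xs d∈
... | b , d≡1+b , b<len , change = b , d≡1+b , s≤s b<len , ≢ᵇ⇒≢ change

∈-Des⁺ : {n b : ℕ} (σ : Permutation n n) → suc b < n →
         nth (permWord σ) (suc b) < nth (permWord σ) b → suc b ∈ Des σ
∈-Des⁺ σ 1+b<n = ∈-descAux⁺ (permWord σ) (subst (_ <_) (sym (length-permWord σ)) 1+b<n)

∈-Des⁻ : {n d : ℕ} (σ : Permutation n n) → d ∈ Des σ →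
         ∃[ b ] (d ≡ suc b × suc b < n × nth (permWord σ) (suc b) < nth (permWord σ) b)
∈-Des⁻ σ d∈ with ∈-descAux⁻ (permWord σ) d∈
... | b , d≡1+b , 1+b<len , descent = b , d≡1+b , subst (_ <_) (length-permWord σ) 1+b<len , descent

refines-expComp-C⇔ : {n : ℕ} (σ : Permutation n n) {u : List ℕ} → Linked _≤_ u → length u ≡ n →
                     T (refines (expComp u) (C σ)) ⇔ StrictAtDescents σ u
refines-expComp-C⇔ {zero} σ _ _ = mk⇔ (λ _ _ ()) (λ _ → _)
refines-expComp-C⇔ {suc n} σ {x ∷ xs} u↗ refl = mk⇔
  (λ J≼I → ⊆⇒strict (subst₂ _⊆_ (partialSums-C σ) (partialSums-expComp x xs)
                               (Equivalence.to (T-refines⇔ (expComp (x ∷ xs)) (C σ)) J≼I)))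
  (λ strict → Equivalence.from (T-refines⇔ (expComp (x ∷ xs)) (C σ))
                (subst₂ _⊆_ (sym (partialSums-C σ)) (sym (partialSums-expComp x xs))
                        (strict⇒⊆ strict)))
  where
  u : List ℕ
  u = x ∷ xs
  Changes : List ℕ
  Changes = positionsAfter _≢ᵇ_ 1 x xs
  ⊆⇒strict : Des σ ++ [ suc n ] ⊆ Changes ++ [ suc (length xs) ] → StrictAtDescents σ u
  ⊆⇒strict Des⊆Changes b 1+b<n descent with ∈-++⁻ Changes (Des⊆Changes (∈-++⁺ˡ (∈-Des⁺ σ 1+b<n descent)))
  ... | inj₁ 1+b∈ with ∈-changes⁻ x xs 1+b∈
  ...   | _ , refl , _ , change = ≤∧≢⇒< (nth-mono u↗ (n≤1+n b) 1+b<n) change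
  ⊆⇒strict _ b 1+b<n _ | inj₂ (here 1+b≡1+n) = ⊥-elim (<-irrefl 1+b≡1+n 1+b<n)
  strict⇒⊆ : StrictAtDescents σ u → Des σ ++ [ suc n ] ⊆ Changes ++ [ suc (length xs) ]
  strict⇒⊆ strict s∈ with ∈-++⁻ (Des σ) s∈
  ... | inj₁ s∈Des with ∈-Des⁻ σ s∈Des
  ...   | b , refl , 1+b<n , descent = ∈-++⁺ˡ (∈-changes⁺ x xs 1+b<n (<⇒≢ (strict b 1+b<n descent)))
  strict⇒⊆ strict s∈ | inj₂ (here refl) = ∈-++⁺ʳ Changes (here refl)

T-stdIsInv⇔ : {n : ℕ} (σ : Permutation n n) (w : Vec ℕ n) → T (stdIsInv σ w) ⇔ std w ≡ invWord σ
T-stdIsInv⇔ σ w with Vecₚ.≡-dec _≟_ (std w) (invWord σ)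
... | yes std≡ = mk⇔ (λ _ → std≡) (λ _ → _)
... | no std≢ = mk⇔ (λ ()) std≢

stdIsInv-unsort : {n : ℕ} (σ : Permutation n n) {u : List ℕ} → Linked _≤_ u → length u ≡ n →
                  stdIsInv σ (unsort σ u) ≡ refines (expComp u) (C σ)
stdIsInv-unsort σ {u} u↗ |u|≡n = T-injective (mk⇔
  (Equivalence.from strict⇔refines ∘ std-unsort⇒strictAtDescents σ u ∘ Equivalence.to (T-stdIsInv⇔ σ (unsort σ u)))
  (Equivalence.from (T-stdIsInv⇔ σ (unsort σ u)) ∘ strictAtDescents⇒std-unsort σ u↗ |u|≡n
     ∘ Equivalence.to strict⇔refines))
  where
  strict⇔refines : T (refines (expComp u) (C σ)) ⇔ StrictAtDescents σ u
  strict⇔refines = refines-expComp-C⇔ σ u↗ |u|≡n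

-- Normal ordering in the quantum affine space

-- The number of pairs (x ∈ js, y ∈ m) with x < y; each costs a factor q when the letters
-- of js are multiplied onto the normal-ordered monomial m.
crossings : List ℕ → List ℕ → ℕ
crossings m js = sum (map (λ x → count (x <ᵇ_) m) js)

crossings-[] : (js : List ℕ) → crossings [] js ≡ 0
crossings-[] [] = refl
crossings-[] (_ ∷ js) = crossings-[] js

-- Quantum.insert does not involve the ring, but it is only available inside Quantum,
-- so the insertion-sort lemmas below are stated over an arbitrary R and q.
module QuantumProperties {c ℓ : Level} (R : CommutativeRing c ℓ) (q : CommutativeRing.Carrier R) where
  open Quantum R q
  module R = CommutativeRing R

  insert≡ : (j : ℕ) (m : List ℕ) → insert j m ≡ InsertionSort.insert j m
  insert≡ j [] = refl
  insert≡ j (i ∷ m) = cong (λ l → if j ≤ᵇ i then j ∷ i ∷ m else i ∷ l) (insert≡ j m)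

  insert-↭ : (j : ℕ) (m : List ℕ) → insert j m ↭ j ∷ m
  insert-↭ j m = subst (_↭ j ∷ m) (sym (insert≡ j m)) (InsertionSortₚ.insert-↭ j m)

  insert-↗ : (j : ℕ) {m : List ℕ} → Linked _≤_ m → Linked _≤_ (insert j m)
  insert-↗ j {m} m↗ = subst (Linked _≤_) (sym (insert≡ j m)) (InsertionSortₚ.insert-↗ j m↗)

  count-insert : (p : ℕ → Bool) (j : ℕ) (m : List ℕ) → count p (insert j m) ≡ 𝟙 (p j) + count p m
  count-insert p j m = trans (count-↭ p (insert-↭ j m)) (count-∷ p j m)

  insertAll : List ℕ → List ℕ → List ℕ
  insertAll m [] = m
  insertAll m (j ∷ js) = insertAll (insert j m) js

  insertAll-↭ : (m js : List ℕ) → insertAll m js ↭ m ++ js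
  insertAll-↭ m [] = ↭.↭-sym (↭ₚ.++-identityʳ m)
  insertAll-↭ m (j ∷ js) = ↭.↭-trans (insertAll-↭ (insert j m) js)
    (↭.↭-trans (↭ₚ.++⁺ʳ js (insert-↭ j m)) (↭.↭-sym (↭ₚ.shift j m js)))

  insertAll-↗ : {m : List ℕ} (js : List ℕ) → Linked _≤_ m → Linked _≤_ (insertAll m js)
  insertAll-↗ [] m↗ = m↗
  insertAll-↗ (j ∷ js) m↗ = insertAll-↗ js (insert-↗ j m↗)

  sortWord : {n : ℕ} → Vec ℕ n → List ℕ
  sortWord w = insertAll [] (toList w)

  sortWord-↗ : {n : ℕ} (w : Vec ℕ n) → Linked _≤_ (sortWord w)
  sortWord-↗ w = insertAll-↗ (toList w) Linked.[]

  length-sortWord : {n : ℕ} (w : Vec ℕ n) → length (sortWord w) ≡ n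
  length-sortWord w = trans (↭ₚ.↭-length (insertAll-↭ [] (toList w))) (Vecₚ.length-toList w)

  count-sortWord : {n : ℕ} (p : ℕ → Bool) (w : Vec ℕ n) → count p (sortWord w) ≡ countFin (p ∘ lookup w)
  count-sortWord p w = trans (count-↭ p (insertAll-↭ [] (toList w))) (count-toList p w)

  -- Std(w)_i is at least #{k | w_k < w_i} and below #{k | w_k ≤ w_i}: the positions of the sorted word holding w_i.
  sortWord-at-std : {n : ℕ} (w : Vec ℕ n) (i : Fin n) → nth (sortWord w) (lookup (std w) i) ≡ lookup w i
  sortWord-at-std {n} w i = nth-sorted-count (sortWord w) (lookup (std w) i) (sortWord-↗ w) fewer-smaller enough-atMost
    where
    x : ℕ
    x = lookup w i
    precedes-i : Fin n → Bool
    precedes-i k = key w k <ₗₑₓᵇ key w i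
    fewer-smaller : count (_<ᵇ x) (sortWord w) ≤ lookup (std w) i
    fewer-smaller = subst₂ _≤_ (sym (count-sortWord (_<ᵇ x) w)) (sym (std-lookup w i))
      (countFin-mono {p = λ k → lookup w k <ᵇ x} {p′ = precedes-i}
        (λ k w[k]<x → <ₗₑₓ⇒<ₗₑₓᵇ {key w k} {key w i} (inj₁ (<ᵇ⇒< _ _ w[k]<x))))
    enough-atMost : lookup (std w) i < count (_≤ᵇ x) (sortWord w)
    enough-atMost = subst₂ _<_ (sym (std-lookup w i)) (sym (count-sortWord (_≤ᵇ x) w))
      (countFin-mono-< {p = precedes-i} {p′ = λ k → lookup w k ≤ᵇ x}
        (λ k k≺i → ≤⇒≤ᵇ (<ₗₑₓ⇒≤₁ (<ₗₑₓᵇ⇒<ₗₑₓ (key w k) (key w i) k≺i))) i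
        (Lex.irrefl (refl , refl) ∘ <ₗₑₓᵇ⇒<ₗₑₓ (key w i) (key w i)) (≤⇒≤ᵇ (≤-refl {x})))

  unsort-sortWord : {n : ℕ} (σ : Permutation n n) (w : Vec ℕ n) → std w ≡ invWord σ → w ≡ unsort σ (sortWord w)
  unsort-sortWord σ w std≡ = trans (sym (Vecₚ.tabulate∘lookup w)) (Vecₚ.tabulate-cong λ i → begin
    lookup w i                                ≡⟨ sym (sortWord-at-std w i) ⟩
    nth (sortWord w) (lookup (std w) i)       ≡⟨ cong (nth (sortWord w)) (Equivalence.to (std≡invWord⇔ σ w) std≡ i) ⟩
    nth (sortWord w) (rank σ i)               ∎)
    where open ≡-Reasoning

  sortWord-unsort : {n : ℕ} (σ : Permutation n n) (u : List ℕ) → length u ≡ n →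
                    std (unsort σ u) ≡ invWord σ → sortWord (unsort σ u) ≡ u
  sortWord-unsort {n} σ u |u|≡n std≡ = nth-ext (sortWord w) u (trans (length-sortWord w) (sym |u|≡n)) agree
    where
    w : Vec ℕ n
    w = unsort σ u
    agree : ∀ j → j < length (sortWord w) → nth (sortWord w) j ≡ nth u j
    agree j j<len = begin
      nth (sortWord w) j                    ≡⟨ cong (nth (sortWord w)) (sym (rank-σ-fromℕ< σ j<n)) ⟩
      nth (sortWord w) (rank σ i)           ≡⟨ cong (nth (sortWord w)) (sym (Equivalence.to (std≡invWord⇔ σ w) std≡ i)) ⟩
      nth (sortWord w) (lookup (std w) i)   ≡⟨ sortWord-at-std w i ⟩
      lookup w i                            ≡⟨ lookup-unsort-fromℕ< σ u j<n ⟩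
      nth u j                               ∎
      where
      open ≡-Reasoning
      j<n : j < n
      j<n = subst (j <_) (length-sortWord w) j<len
      i : Fin n
      i = σ ⟨$⟩ʳ fromℕ< j<n

  crossings-insert : (j : ℕ) (m js : List ℕ) → crossings (insert j m) js ≡ count (_<ᵇ j) js + crossings m js
  crossings-insert j m [] = refl
  crossings-insert j m (x ∷ js) = begin
    count (x <ᵇ_) (insert j m) + crossings (insert j m) js
      ≡⟨ cong₂ _+_ (count-insert (x <ᵇ_) j m) (crossings-insert j m js) ⟩
    (𝟙 (x <ᵇ j) + count (x <ᵇ_) m) + (count (_<ᵇ j) js + crossings m js)
      ≡⟨ solve 4 (λ a b c d → (a :+ b) :+ (c :+ d) := (a :+ c) :+ (b :+ d)) refl
               (𝟙 (x <ᵇ j)) (count (x <ᵇ_) m) (count (_<ᵇ j) js) (crossings m js) ⟩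
    (𝟙 (x <ᵇ j) + count (_<ᵇ j) js) + (count (x <ᵇ_) m + crossings m js)
      ≡⟨ cong (_+ crossings m (x ∷ js)) (sym (count-∷ (_<ᵇ j) x js)) ⟩
    count (_<ᵇ j) (x ∷ js) + crossings m (x ∷ js) ∎
    where open ≡-Reasoning

  pow-+ : (a b : ℕ) → pow q (a + b) R.≈ pow q a R.* pow q b
  pow-+ zero b = R.sym (R.*-identityˡ _)
  pow-+ (suc a) b = R.trans (R.*-congˡ (pow-+ a b)) (R.sym (R.*-assoc q (pow q a) (pow q b)))

  mulWord-monomial : (t : Term) (js : List ℕ) → proj₂ (mulWord t js) ≡ insertAll (proj₂ t) js
  mulWord-monomial t [] = refl
  mulWord-monomial t (j ∷ js) = mulWord-monomial (mulVar t j) js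

  mulWord-coefficient : (a : R.Carrier) (m js : List ℕ) →
                        proj₁ (mulWord (a , m) js) R.≈ a R.* pow q (crossings m js + wordInversions js)
  mulWord-coefficient a m [] = R.sym (R.*-identityʳ a)
  mulWord-coefficient a m (j ∷ js) = begin
    proj₁ (mulWord (a R.* pow q d , insert j m) js)                  ≈⟨ mulWord-coefficient _ (insert j m) js ⟩
    (a R.* pow q d) R.* pow q e                                       ≈⟨ R.*-assoc a (pow q d) (pow q e) ⟩
    a R.* (pow q d R.* pow q e)                                       ≈⟨ R.*-congˡ (R.sym (pow-+ d e)) ⟩
    a R.* pow q (d + e)                                               ≡⟨ cong (λ k → a R.* pow q k) exponent ⟩
    a R.* pow q (crossings m (j ∷ js) + wordInversions (j ∷ js))      ∎
    where
    open SetoidReasoning R.setoid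
    d e : ℕ
    d = count (j <ᵇ_) m
    e = crossings (insert j m) js + wordInversions js
    exponent : d + e ≡ (d + crossings m js) + (count (_<ᵇ j) js + wordInversions js)
    exponent = trans (cong (λ x → d + (x + wordInversions js)) (crossings-insert j m js))
      (solve 4 (λ x y z t → x :+ ((y :+ z) :+ t) := (x :+ z) :+ (y :+ t)) refl
             d (count (_<ᵇ j) js) (crossings m js) (wordInversions js))

  φ-monomial : {n : ℕ} (w : Vec ℕ n) → proj₂ (φ w) ≡ sortWord w
  φ-monomial w = mulWord-monomial (R.1# , []) (toList w)

  φ-coefficient : {n : ℕ} (σ : Permutation n n) (w : Vec ℕ n) → std w ≡ invWord σ →
                  proj₁ (φ w) R.≈ pow q (inversions σ)
  φ-coefficient σ w std≡ = R.trans (mulWord-coefficient R.1# [] (toList w))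
    (R.trans (R.*-identityˡ _) (R.reflexive (cong (pow q) exponent)))
    where
    exponent : crossings [] (toList w) + wordInversions (toList w) ≡ inversions σ
    exponent = trans (cong₂ _+_ (crossings-[] (toList w)) (wordInversions-toList w)) (inversionsOf-std σ w std≡)

  Σ-cong : {A : Set} (xs : List A) {f g : A → R.Carrier} → (∀ x → f x R.≈ g x) → Σ xs f R.≈ Σ xs g
  Σ-cong [] f≈g = R.refl
  Σ-cong (x ∷ xs) f≈g = R.+-cong (f≈g x) (Σ-cong xs f≈g)

  Σ-vanishing : {A : Set} (xs : List A) {f : A → R.Carrier} → (∀ x → f x R.≈ R.0#) → Σ xs f R.≈ R.0#
  Σ-vanishing [] f≈0 = R.refl
  Σ-vanishing (x ∷ xs) f≈0 = R.trans (R.+-cong (f≈0 x) (Σ-vanishing xs f≈0)) (R.+-identityʳ R.0#)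

  Σ-++ : {A : Set} (xs ys : List A) (f : A → R.Carrier) → Σ (xs ++ ys) f R.≈ Σ xs f R.+ Σ ys f
  Σ-++ [] ys f = R.sym (R.+-identityˡ _)
  Σ-++ (x ∷ xs) ys f = R.trans (R.+-congˡ (Σ-++ xs ys f)) (R.sym (R.+-assoc _ _ _))

  Σ-map : {A B : Set} (h : A → B) (ys : List A) (f : B → R.Carrier) → Σ (map h ys) f ≡ Σ ys (f ∘ h)
  Σ-map h [] f = refl
  Σ-map h (y ∷ ys) f = cong (f (h y) R.+_) (Σ-map h ys f)

  Σ-concatMap-map : {A B C : Set} (h : A → B → C) (g : A → List B) (xs : List A) (f : C → R.Carrier) →
                    Σ (List.concatMap (λ a → map (h a) (g a)) xs) f R.≈ Σ xs (λ a → Σ (g a) (f ∘ h a))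
  Σ-concatMap-map h g [] f = R.refl
  Σ-concatMap-map h g (x ∷ xs) f = R.trans (Σ-++ (map (h x) (g x)) _ f)
    (R.+-cong (R.reflexive (Σ-map (h x) (g x) f)) (Σ-concatMap-map h g xs f))

  Σ-applyUpTo-vanishing : (M : ℕ) (g : ℕ → ℕ) (h : ℕ → R.Carrier) → (∀ k → k < M → h (g k) R.≈ R.0#) →
                          Σ (List.applyUpTo g M) h R.≈ R.0#
  Σ-applyUpTo-vanishing zero g h _ = R.refl
  Σ-applyUpTo-vanishing (suc M) g h h≈0 = R.trans
    (R.+-cong (h≈0 0 z<s) (Σ-applyUpTo-vanishing M (g ∘ suc) h (λ k k<M → h≈0 (suc k) (s≤s k<M))))
    (R.+-identityʳ R.0#)

  Σ-applyUpTo-single : (M : ℕ) (g : ℕ → ℕ) (h : ℕ → R.Carrier) {k₀ : ℕ} → k₀ < M →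
                       (∀ k → k ≢ k₀ → h (g k) R.≈ R.0#) → Σ (List.applyUpTo g M) h R.≈ h (g k₀)
  Σ-applyUpTo-single (suc M) g h {zero} _ h≈0 = R.trans
    (R.+-congˡ (Σ-applyUpTo-vanishing M (g ∘ suc) h (λ k _ → h≈0 (suc k) (λ ()))))
    (R.+-identityʳ _)
  Σ-applyUpTo-single (suc M) g h {suc k₀} k₀<M h≈0 = R.trans
    (R.+-cong (h≈0 0 (λ ()))
      (Σ-applyUpTo-single M (g ∘ suc) h (s≤s⁻¹ k₀<M) (λ k k≢k₀ → h≈0 (suc k) (k≢k₀ ∘ suc-injective))))
    (R.+-identityˡ _)

  Σ-words-single : (N : ℕ) {n : ℕ} (v : Vec ℕ n) → (∀ i → lookup v i < N) → (f : Vec ℕ n → R.Carrier) →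
                   (∀ w → w ≢ v → f w R.≈ R.0#) → Σ (words N n) f R.≈ f v
  Σ-words-single N Vec.[] _ f _ = R.+-identityʳ (f Vec.[])
  Σ-words-single N {suc n} (x Vec.∷ v) v<N f f≈0 = begin
    Σ (words N (suc n)) f
      ≈⟨ Σ-concatMap-map Vec._∷_ (λ _ → words N n) (List.upTo N) f ⟩
    Σ (List.upTo N) (λ a → Σ (words N n) (λ w → f (a Vec.∷ w)))
      ≈⟨ Σ-applyUpTo-single N id _ (v<N zero)
           (λ a a≢x → Σ-vanishing (words N n) (λ w → f≈0 (a Vec.∷ w) (a≢x ∘ Vecₚ.∷-injectiveˡ))) ⟩
    Σ (words N n) (λ w → f (x Vec.∷ w))
      ≈⟨ Σ-words-single N v (v<N ∘ suc) (λ w → f (x Vec.∷ w))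
           (λ w w≢v → f≈0 (x Vec.∷ w) (w≢v ∘ Vecₚ.∷-injectiveʳ)) ⟩
    f (x Vec.∷ v) ∎
    where open SetoidReasoning R.setoid

  Σ-compsF-single : (fuel m : ℕ) {J₀ : List ℕ} → m ≤ fuel → All (0 <_) J₀ → sum J₀ ≡ m →
                    (g : List ℕ → R.Carrier) → (∀ J → J ≢ J₀ → g J R.≈ R.0#) → Σ (compsF fuel m) g R.≈ g J₀
  Σ-compsF-single fuel zero {[]} _ _ _ g _ = R.+-identityʳ (g [])
  Σ-compsF-single fuel zero {zero ∷ _} _ (() All.∷ _) _ g _
  Σ-compsF-single fuel zero {suc _ ∷ _} _ _ () g _
  Σ-compsF-single zero (suc m) () _ _ g _
  Σ-compsF-single (suc fuel) (suc m) {[]} _ _ () g _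
  Σ-compsF-single (suc fuel) (suc m) {zero ∷ _} _ (() All.∷ _) _ g _
  Σ-compsF-single (suc fuel) (suc m) {suc k₀ ∷ J₀} (s≤s m≤fuel) (_ All.∷ J₀⁺) ΣJ₀≡1+m g g≈0 = begin
    Σ (compsF (suc fuel) (suc m)) g
      ≈⟨ Σ-concatMap-map (λ k → suc k ∷_) (λ k → compsF fuel (m ∸ k)) (List.upTo (suc m)) g ⟩
    Σ (List.upTo (suc m)) (λ k → Σ (compsF fuel (m ∸ k)) (λ J → g (suc k ∷ J)))
      ≈⟨ Σ-applyUpTo-single (suc m) id _ (s≤s k₀≤m)
           (λ k k≢k₀ → Σ-vanishing (compsF fuel (m ∸ k))
              (λ J → g≈0 (suc k ∷ J) (k≢k₀ ∘ suc-injective ∘ Listₚ.∷-injectiveˡ))) ⟩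
    Σ (compsF fuel (m ∸ k₀)) (λ J → g (suc k₀ ∷ J))
      ≈⟨ Σ-compsF-single fuel (m ∸ k₀) (≤-trans (m∸n≤m m k₀) m≤fuel) J₀⁺ ΣJ₀≡m∸k₀ (λ J → g (suc k₀ ∷ J))
           (λ J J≢J₀ → g≈0 (suc k₀ ∷ J) (J≢J₀ ∘ Listₚ.∷-injectiveʳ)) ⟩
    g (suc k₀ ∷ J₀) ∎
    where
    open SetoidReasoning R.setoid
    k₀+ΣJ₀≡m : k₀ + sum J₀ ≡ m
    k₀+ΣJ₀≡m = suc-injective ΣJ₀≡1+m
    k₀≤m : k₀ ≤ m
    k₀≤m = subst (k₀ ≤_) k₀+ΣJ₀≡m (m≤m+n k₀ (sum J₀))
    ΣJ₀≡m∸k₀ : sum J₀ ≡ m ∸ k₀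
    ΣJ₀≡m∸k₀ = trans (sym (m+n∸m≡n k₀ (sum J₀))) (cong (_∸ k₀) k₀+ΣJ₀≡m)

  Σ-compsF-vanishing : (fuel m : ℕ) (g : List ℕ → R.Carrier) → (∀ J → sum J ≡ m → g J R.≈ R.0#) →
                       Σ (compsF fuel m) g R.≈ R.0#
  Σ-compsF-vanishing fuel zero g g≈0 = R.trans (R.+-identityʳ _) (g≈0 [] refl)
  Σ-compsF-vanishing zero (suc m) g _ = R.refl
  Σ-compsF-vanishing (suc fuel) (suc m) g g≈0 = R.trans
    (Σ-concatMap-map (λ k → suc k ∷_) (λ k → compsF fuel (m ∸ k)) (List.upTo (suc m)) g)
    (Σ-applyUpTo-vanishing (suc m) id _ λ k k<1+m → Σ-compsF-vanishing fuel (m ∸ k) (λ J → g (suc k ∷ J))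
      λ J ΣJ≡m∸k → g≈0 (suc k ∷ J) (cong suc (trans (cong (k +_) ΣJ≡m∸k) (m+[n∸m]≡n (s≤s⁻¹ k<1+m)))))

  [_]ᴿ : Bool → R.Carrier
  [ b ]ᴿ = if b then R.1# else R.0#

  if-same : (b : Bool) (x : R.Carrier) → (if b then x else x) ≡ x
  if-same true x = refl
  if-same false x = refl

  coeffAt-≢ : (t : Term) {u : List ℕ} → proj₂ t ≢ u → coeffAt u t ≡ R.0#
  coeffAt-≢ (a , m) {u} m≢u = cong (λ b → if b then a else R.0#) (dec-false (Listₚ.≡-dec _≟_ m u) m≢u)

  coeffAt-≡ : (t : Term) {u : List ℕ} → proj₂ t ≡ u → coeffAt u t ≡ proj₁ t
  coeffAt-≡ (a , m) refl = cong (λ b → if b then a else R.0#) (dec-true (Listₚ.≡-dec _≟_ m m) refl)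

  FbarTerm : List ℕ → List ℕ → List ℕ → R.Carrier
  FbarTerm I u J = if refines J I then MbarCoeff J u else R.0#

  FbarTerm-≢ : (I u J : List ℕ) → J ≢ expComp u → FbarTerm I u J R.≈ R.0#
  FbarTerm-≢ I u J J≢ = R.reflexive (trans
    (cong (λ b → if refines J I then [ b ]ᴿ else R.0#) (dec-false (Listₚ.≡-dec _≟_ (expComp u) J) (J≢ ∘ sym)))
    (if-same (refines J I) R.0#))

  FbarCoeff-expComp : (I u : List ℕ) → sum I ≡ length u → FbarCoeff I u R.≈ [ refines (expComp u) I ]ᴿ
  FbarCoeff-expComp I u ΣI≡|u| = R.trans
    (Σ-compsF-single (sum I) (sum I) ≤-refl (expComp-positive u) (trans (sum-expComp u) (sym ΣI≡|u|))
      (FbarTerm I u) (FbarTerm-≢ I u))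
    (R.reflexive (cong (λ b → if refines (expComp u) I then [ b ]ᴿ else R.0#)
      (dec-true (Listₚ.≡-dec _≟_ (expComp u) (expComp u)) refl)))

  FbarCoeff-vanishing : (I u : List ℕ) → sum I ≢ length u → FbarCoeff I u R.≈ R.0#
  FbarCoeff-vanishing I u ΣI≢|u| = Σ-compsF-vanishing (sum I) (sum I) (FbarTerm I u) λ J ΣJ≡ΣI →
    FbarTerm-≢ I u J (λ J≡ → ΣI≢|u| (trans (sym ΣJ≡ΣI) (trans (cong sum J≡) (sum-expComp u))))

  lhsTerm : {n : ℕ} → Permutation n n → List ℕ → Vec ℕ n → R.Carrier
  lhsTerm σ u w = if stdIsInv σ w then coeffAt u (φ w) else R.0#

  lhsTerm-vanishing : {n : ℕ} (σ : Permutation n n) (u : List ℕ) (w : Vec ℕ n) →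
                      (std w ≡ invWord σ → sortWord w ≢ u) → lhsTerm σ u w R.≈ R.0#
  lhsTerm-vanishing σ u w off with Vecₚ.≡-dec _≟_ (std w) (invWord σ)
  ... | no _ = R.refl
  ... | yes std≡ = R.reflexive (coeffAt-≢ (φ w) (off std≡ ∘ trans (sym (φ-monomial w))))

  lhsCoeff-vanishing : {n : ℕ} (σ : Permutation n n) (N : ℕ) {u : List ℕ} → length u ≢ n →
                       lhsCoeff σ N u R.≈ R.0#
  lhsCoeff-vanishing {n} σ N {u} |u|≢n = Σ-vanishing (words N n) λ w → lhsTerm-vanishing σ u w λ _ sort≡u →
    |u|≢n (trans (cong length (sym sort≡u)) (length-sortWord w))

  lhsCoeff-unsort : {n : ℕ} (σ : Permutation n n) (N : ℕ) {u : List ℕ} → length u ≡ n → All (_< N) u →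
               lhsCoeff σ N u R.≈ pow q (inversions σ) R.* [ stdIsInv σ (unsort σ u) ]ᴿ
  lhsCoeff-unsort {n} σ N {u} |u|≡n u<N =
    R.trans (Σ-words-single N (unsort σ u) unsort<N (lhsTerm σ u) off-unsort) at-unsort
    where
    unsort<N : ∀ i → lookup (unsort σ u) i < N
    unsort<N i = subst (_< N) (sym (lookup-unsort σ u i))
      (nth-All u<N (rank σ i) (subst (rank σ i <_) (sym |u|≡n) (rank<n σ i)))
    off-unsort : ∀ w → w ≢ unsort σ u → lhsTerm σ u w R.≈ R.0#
    off-unsort w w≢ = lhsTerm-vanishing σ u w λ std≡ sort≡u →
      w≢ (trans (unsort-sortWord σ w std≡) (cong (unsort σ) sort≡u))
    at-unsort : lhsTerm σ u (unsort σ u) R.≈ pow q (inversions σ) R.* [ stdIsInv σ (unsort σ u) ]ᴿ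
    at-unsort with Vecₚ.≡-dec _≟_ (std (unsort σ u)) (invWord σ)
    ... | no _ = R.sym (R.zeroʳ _)
    ... | yes std≡ = R.trans
      (R.reflexive (coeffAt-≡ (φ (unsort σ u)) (trans (φ-monomial (unsort σ u)) (sortWord-unsort σ u |u|≡n std≡))))
      (R.trans (φ-coefficient σ (unsort σ u) std≡) (R.sym (R.*-identityʳ _)))

mainTheorem6 : {c ℓ : Level} (R : CommutativeRing c ℓ) (q : CommutativeRing.Carrier R)
    (n : ℕ) (σ : Permutation n n) (N : ℕ) (u : List ℕ) →
    Linked _≤_ u → All (_< N) u →
    CommutativeRing._≈_ R (Quantum.lhsCoeff R q σ N u)
      (CommutativeRing._*_ R (Quantum.pow R q q (inversions σ)) (Quantum.FbarCoeff R q (C σ) u))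
mainTheorem6 R q n σ N u u↗ u<N = by-length (length u ≟ n)
  where
  open CommutativeRing R using (_≈_; _*_; 0#; setoid; *-congˡ; zeroʳ) renaming (sym to ≈-sym)
  open Quantum R q using (lhsCoeff; FbarCoeff; pow)
  open QuantumProperties R q
  open SetoidReasoning setoid
  by-length : Dec (length u ≡ n) → lhsCoeff σ N u ≈ pow q (inversions σ) * FbarCoeff (C σ) u
  by-length (yes |u|≡n) = begin
    lhsCoeff σ N u
      ≈⟨ lhsCoeff-unsort σ N |u|≡n u<N ⟩
    pow q (inversions σ) * [ stdIsInv σ (unsort σ u) ]ᴿ
      ≡⟨ cong (λ b → pow q (inversions σ) * [ b ]ᴿ) (stdIsInv-unsort σ u↗ |u|≡n) ⟩
    pow q (inversions σ) * [ refines (expComp u) (C σ) ]ᴿ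
      ≈⟨ *-congˡ (≈-sym (FbarCoeff-expComp (C σ) u (trans (sum-C σ) (sym |u|≡n)))) ⟩
    pow q (inversions σ) * FbarCoeff (C σ) u ∎
  by-length (no |u|≢n) = begin
    lhsCoeff σ N u
      ≈⟨ lhsCoeff-vanishing σ N |u|≢n ⟩
    0#
      ≈⟨ ≈-sym (zeroʳ (pow q (inversions σ))) ⟩
    pow q (inversions σ) * 0#
      ≈⟨ *-congˡ (≈-sym (FbarCoeff-vanishing (C σ) u (λ ΣC≡|u| → |u|≢n (trans (sym ΣC≡|u|) (sum-C σ))))) ⟩
    pow q (inversions σ) * FbarCoeff (C σ) u ∎
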